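{- Let $G$ be a graph, $k$ a positive integer, and $\mathcal{F}$ a layered family of $G$ with thickness at most $k$. Then for every $F\in\mathcal{F}$ and every upward minimal path $P$ in $G$, $|F\cap V(P)|\le 2k-1$.
   Context: Layered family: given an ordered partition $\Pi=(L_1,\dots,L_m)$ of $V(G)$, the layer digraph has an arc $(u,v)$ iff $uv\in E(G)$, $u\in L_i$, $v\in L_j$, $j<i$. $v$ is a descendant of $u$, and $u$ an ancestor of $v$, if there is a directed path from $u$ to $v$ (including $u=v$). For each vertex $u$ with no in-arcs, the set of $u$ and all its descendants belongs to $\mathcal{F}$. Thickness: smallest $k$ such that every member of $\mathcal{F}$ meets at most $k$ parts of $\Pi$. The upward closure $\widehat{S}$ of $S\subseteq V(G)$ is the set of all ancestors of vertices of $S$. A $u$--$v$ path $P$ is upward minimal if there is no $u$--$v$ path $P'$ with $\widehat{V(P')}\subsetneq\widehat{V(P)}$, or with $\widehat{V(P')}=\widehat{V(P)}$ and $|V(P')|<|V(P)|$. -}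

module Defs where

open import Level using (0ℓ)
open import Data.Nat using (ℕ; _≤_; _<_)
open import Data.Fin using (Fin; toℕ)
open import Data.List using (List; []; _∷_; [_]; length)
open import Data.List.Membership.Propositional using (_∈_)
open import Data.List.Relation.Unary.Unique.Propositional using (Unique)
open import Data.Product using (Σ; ∃; _×_)
open import Relation.Nullary using (¬_)
open import Relation.Binary.PropositionalEquality using (_≡_)

record Graph (n : ℕ) : Set₁ where
  field
    Adj     : Fin n → Fin n → Set
    sym     : ∀ {u v} → Adj u v → Adj v u
    irrefl  : ∀ {u} → ¬ Adj u u

-- An ordered partition (L_1,…,L_m) of V(G) is given by the map
-- layer : Fin n → Fin m sending v to the index i with v ∈ L_i.

module Layered {n m : ℕ} (G : Graph n) (layer : Fin n → Fin m) where
  open Graph G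

  Arc : Fin n → Fin n → Set
  Arc u v = Adj u v × (toℕ (layer v) < toℕ (layer u))

  data Desc : Fin n → Fin n → Set where
    here  : ∀ {u} → Desc u u
    step  : ∀ {u w v} → Arc u w → Desc w v → Desc u v

  Root : Fin n → Set
  Root u = ∀ w → ¬ Arc w u

  -- the member of 𝓕 generated by a root u: u together with its descendants
  Member : Fin n → Fin n → Set
  Member u v = Desc u v

  MeetsAtMost : (Fin n → Set) → ℕ → Set
  MeetsAtMost F k = Σ (List (Fin m)) λ ls →
    (length ls ≤ k) × (∀ v → F v → layer v ∈ ls)

  ThicknessAtMost : ℕ → Set
  ThicknessAtMost k = ∀ u → Root u → MeetsAtMost (Member u) k

  Up : List (Fin n) → Fin n → Set
  Up S x = Σ (Fin n) λ s → (s ∈ S) × Desc x s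

  data Walk : Fin n → Fin n → List (Fin n) → Set where
    single : ∀ {u} → Walk u u [ u ]
    cons   : ∀ {u w v xs} → Adj u w → Walk w v xs → Walk u v (u ∷ xs)

  IsPath : Fin n → Fin n → List (Fin n) → Set
  IsPath u v xs = Walk u v xs × Unique xs

  _⊆ᵤ_ : (Fin n → Set) → (Fin n → Set) → Set
  A ⊆ᵤ B = ∀ x → A x → B x

  UpwardMinimal : Fin n → Fin n → List (Fin n) → Set
  UpwardMinimal u v P = IsPath u v P ×
    (∀ P' → IsPath u v P' →
       ¬ ((Up P' ⊆ᵤ Up P) × ¬ (Up P ⊆ᵤ Up P'))
     × ¬ ((Up P' ⊆ᵤ Up P) × (Up P ⊆ᵤ Up P') × (length P' < length P)))

  -- |F ∩ V(P)| ≤ c : every duplicate-free list of vertices lying in both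
  -- F and V(P) has length at most c
  InterCardAtMost : (Fin n → Set) → List (Fin n) → ℕ → Set
  InterCardAtMost F P c = ∀ (xs : List (Fin n)) → Unique xs →
    (∀ x → x ∈ xs → F x × x ∈ P) → length xs ≤ c

-- Let x and z be the first and the last vertex of P lying in F = {r and its
-- descendants}.  Climbing from x up to r and descending from r to z gives a
-- walk from x to z whose vertices are all ancestors of x or z, hence lie in
-- the upward closure of P.  Layers strictly decrease along a descending path,
-- so each half meets at most k layers and the walk has fewer than 2k
-- vertices.  Splicing it into P in place of the segment from x to z yields a
-- u–v path whose upward closure is contained in that of P; by upward
-- minimality it cannot be shorter than P, so the segment, which contains all
-- of F ∩ V(P), has fewer than 2k vertices.
module Submission where

open import Defs
open import Data.Nat using (ℕ; _≤_; _*_; _∸_)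
open import Data.Fin using (Fin)
open import Data.List using (List)

open import Level using (Level)
open import Data.Nat using (suc; _+_; _<_; z≤n; s≤s)
open import Data.Nat.Properties
  using ( ≤-refl; ≤-trans; ≤-pred; m≤n⇒m≤1+n; <-trans; <-irrefl; ≮⇒≥; <⇒≤pred; pred[m∸n]≡m∸[1+n]
        ; +-suc; +-identityʳ; +-mono-≤-<; +-cancelˡ-≤; +-cancelʳ-≤; module ≤-Reasoning )
open import Data.Fin using (toℕ; _≟_)
open import Data.List using ([]; _∷_; [_]; _++_; length; map; reverse; drop)
open import Data.List.Properties
  using (length-++; length-map; length-++-sucʳ; length-++-≤ʳ; length-reverse; ++-assoc; ++-identityʳ; unfold-reverse)
open import Data.List.Membership.Propositional using (_∈_; lose)
open import Data.List.Membership.Propositional.Properties using (∈-++⁺ˡ; ∈-++⁺ʳ; ∈-++⁻; ∈-∃++; ∈-map⁻)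
open import Data.List.Relation.Unary.Any using (Any; here; there; any?)
import Data.List.Relation.Unary.Any.Properties as Any
open import Data.List.Relation.Unary.All using (All; []; _∷_)
import Data.List.Relation.Unary.All as All
import Data.List.Relation.Unary.All.Properties as All
open import Data.List.Relation.Unary.AllPairs using ([]; _∷_)
open import Data.List.Relation.Unary.Unique.Propositional using (Unique)
open import Data.List.Relation.Binary.Subset.Propositional using (_⊆_)
open import Data.List.Relation.Binary.Subset.Propositional.Properties using (All-resp-⊇; xs⊆xs++ys; ++⁺ʳ)
open import Data.Product using (_×_; _,_; proj₁; proj₂; ∃-syntax)
open import Data.Sum using (inj₁; inj₂)
open import Relation.Nullary using (¬_; yes; no; contradiction)
open import Relation.Unary using (Pred; Decidable; ∁)
open import Relation.Binary.PropositionalEquality using (_≡_; refl; sym; trans; cong; subst)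

module _ {a q : Level} {A : Set a} {Q : Pred A q} where

  split-first : Decidable Q → ∀ {xs} → Any Q xs →
    ∃[ B ] ∃[ x ] ∃[ T ] xs ≡ B ++ x ∷ T × Q x × All (∁ Q) B
  split-first Q? {y ∷ ys} qs with Q? y | qs
  ... | yes qy | _       = [] , y , ys , refl , qy , []
  ... | no ¬qy | here qy = contradiction qy ¬qy
  ... | no ¬qy | there qs′
    with B , x , T , refl , qx , B∌ ← split-first Q? qs′ = y ∷ B , x , T , refl , qx , ¬qy ∷ B∌

  split-last : Decidable Q → ∀ {xs} → Any Q xs →
    ∃[ S ] ∃[ z ] ∃[ C ] xs ≡ S ++ z ∷ C × Q z × All (∁ Q) C
  split-last Q? {y ∷ ys} qs with any? Q? ys | qs
  ... | yes qs′ | _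
    with S , z , C , refl , qz , C∌ ← split-last Q? qs′ = y ∷ S , z , C , refl , qz , C∌
  ... | no ¬qs′ | here qy   = [] , y , ys , refl , qy , All.¬Any⇒All¬ ys ¬qs′
  ... | no ¬qs′ | there qs′ = contradiction qs′ ¬qs′

  ∈-between : ∀ {y} B {M C} → All (∁ Q) B → All (∁ Q) C → Q y → y ∈ B ++ M ++ C → y ∈ M
  ∈-between B {M} B∌ C∌ qy y∈ with ∈-++⁻ B y∈
  ... | inj₁ y∈B = contradiction qy (All.lookup B∌ y∈B)
  ... | inj₂ y∈M++C with ∈-++⁻ M y∈M++C
  ...   | inj₁ y∈M = y∈M
  ...   | inj₂ y∈C = contradiction qy (All.lookup C∌ y∈C)

  split-outermost : Decidable Q → ∀ {xs} → Any Q xs →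
    ∃[ B ] ∃[ x ] ∃[ T ] ∃[ S ] ∃[ z ] ∃[ C ]
      xs ≡ B ++ x ∷ T × x ∷ T ≡ S ++ z ∷ C × Q x × Q z × (∀ {y} → Q y → y ∈ xs → y ∈ S ++ [ z ])
  split-outermost Q? qs
    with B , x , T , refl , qx , B∌ ← split-first Q? qs
    with S , z , C , T≡ , qz , C∌ ← split-last Q? {x ∷ T} (here qx) =
    B , x , T , S , z , C , refl , T≡ , qx , qz , λ qy y∈ →
      ∈-between B B∌ C∌ qy (subst (_ ∈_) (cong (B ++_) (trans T≡ (sym (++-assoc S [ z ] C)))) y∈)

module _ {a : Level} {A : Set a} where

  Unique-⊆⇒length≤ : ∀ {xs ys : List A} → Unique xs → xs ⊆ ys → length xs ≤ length ys
  Unique-⊆⇒length≤ {[]}     _            _     = z≤n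
  Unique-⊆⇒length≤ {x ∷ xs} (x∉xs ∷ xs!) xs⊆ys
    with B , D , refl ← ∈-∃++ (xs⊆ys (here refl)) = begin
      suc (length xs)        ≤⟨ s≤s (Unique-⊆⇒length≤ xs! xs⊆B++D) ⟩
      suc (length (B ++ D))  ≡⟨ length-++-sucʳ B x D ⟨
      length (B ++ x ∷ D)    ∎
    where
    open ≤-Reasoning
    xs⊆B++D : xs ⊆ B ++ D
    xs⊆B++D {y} y∈xs with ∈-++⁻ B (xs⊆ys (there y∈xs))
    ... | inj₁ y∈B         = ∈-++⁺ˡ y∈B
    ... | inj₂ (here refl) = contradiction refl (All.lookup x∉xs y∈xs)
    ... | inj₂ (there y∈D) = ∈-++⁺ʳ B y∈D

  Unique-++⁻ʳ : ∀ xs {ys : List A} → Unique (xs ++ ys) → Unique ys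
  Unique-++⁻ʳ []       ys!       = ys!
  Unique-++⁻ʳ (_ ∷ xs) (_ ∷ ys!) = Unique-++⁻ʳ xs ys!

module _ {n m : ℕ} (G : Graph n) (layer : Fin n → Fin m) where
  open Graph G renaming (sym to Adj-sym)
  open Layered G layer
  open import Data.List.Membership.DecPropositional (_≟_ {n}) using (_∈?_)

  private
    variable
      u v w x z r : Fin n
      xs ys P Q X : List (Fin n)

  _++ʷ_ : Walk u x xs → Walk x v ys → Walk u v (xs ++ drop 1 ys)
  single   ++ʷ single    = single
  single   ++ʷ cons a w₂ = cons a w₂
  cons a w ++ʷ w₂        = cons a (w ++ʷ w₂)

  length-Walk : Walk u v xs → length xs ≡ suc (length (drop 1 xs))
  length-Walk single     = refl
  length-Walk (cons _ _) = refl

  -- The case split on B is needed only to rule out the one-vertex walk.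
  Walk-split : ∀ B {T} → Walk u v (B ++ x ∷ T) → Walk u x (B ++ [ x ]) × Walk x v (x ∷ T)
  Walk-split []          single     = single , single
  Walk-split []          (cons a w) = single , cons a w
  Walk-split (_ ∷ [])    (cons a w) = cons a (proj₁ (Walk-split [] w)) , proj₂ (Walk-split [] w)
  Walk-split (_ ∷ b ∷ B) (cons a w) = cons a (proj₁ (Walk-split (b ∷ B) w)) , proj₂ (Walk-split (b ∷ B) w)

  Walk-reverse : Walk u v xs → Walk v u (reverse xs)
  Walk-reverse single = single
  Walk-reverse (cons {u} {xs = xs} a w)
    rewrite unfold-reverse u xs = Walk-reverse w ++ʷ cons (Adj-sym a) single

  -- Loop erasure: cut the walk back to the last visit of its first vertex.
  Walk⇒Path : Walk u v xs → ∃[ ys ] IsPath u v ys × length ys ≤ length xs × ys ⊆ xs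
  Walk⇒Path {u} single = [ u ] , (single , [] ∷ []) , ≤-refl , λ y∈ → y∈
  Walk⇒Path {u} (cons {xs = xs} a w)
    with ys , (w′ , ys!) , |ys|≤ , ys⊆ ← Walk⇒Path w | u ∈? ys
  ... | no u∉ys =
    u ∷ ys , (cons a w′ , All.¬Any⇒All¬ ys u∉ys ∷ ys!) , s≤s |ys|≤ , λ where
      (here refl) → here refl
      (there y∈)  → there (ys⊆ y∈)
  ... | yes u∈ys with B , D , refl ← ∈-∃++ u∈ys =
    u ∷ D , (proj₂ (Walk-split B w′) , Unique-++⁻ʳ B ys!) ,
    ≤-trans (length-++-≤ʳ (u ∷ D) {B}) (m≤n⇒m≤1+n |ys|≤) ,
    λ y∈ → there (ys⊆ (∈-++⁺ʳ B y∈))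

  Desc-trans : Desc u w → Desc w v → Desc u v
  Desc-trans here           w⇝v = w⇝v
  Desc-trans (step arc u⇝w) w⇝v = step arc (Desc-trans u⇝w w⇝v)

  steps : Desc u v → List (Fin n)
  steps here                 = []
  steps (step {w = w} _ w⇝v) = w ∷ steps w⇝v

  vertices : Desc u v → List (Fin n)
  vertices {u} u⇝v = u ∷ steps u⇝v

  Desc⇒Walk : (d : Desc u v) → Walk u v (vertices d)
  Desc⇒Walk here           = single
  Desc⇒Walk (step arc w⇝v) = cons (proj₁ arc) (Desc⇒Walk w⇝v)

  vertices-ancestors : (d : Desc u v) → All (λ c → Desc c v) (vertices d)
  vertices-ancestors here           = here ∷ []
  vertices-ancestors (step arc w⇝v) = step arc w⇝v ∷ vertices-ancestors w⇝v

  vertices-descendants : (d : Desc u v) → All (Desc u) (vertices d)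
  vertices-descendants here           = here ∷ []
  vertices-descendants (step arc w⇝v) = here ∷ All.map (step arc) (vertices-descendants w⇝v)

  steps-lower : (d : Desc u v) → All (λ c → toℕ (layer c) < toℕ (layer u)) (steps d)
  steps-lower here           = []
  steps-lower (step arc w⇝v) =
    proj₂ arc ∷ All.map (λ c<w → <-trans c<w (proj₂ arc)) (steps-lower w⇝v)

  layers-distinct : (d : Desc u v) → Unique (map layer (vertices d))
  layers-distinct here           = [] ∷ []
  layers-distinct (step arc w⇝v) =
    All.map⁺ (All.map (λ c<u eq → <-irrefl (cong toℕ (sym eq)) c<u) (steps-lower (step arc w⇝v)))
    ∷ layers-distinct w⇝v

  length-vertices≤ : ∀ {k} → MeetsAtMost (Desc u) k → (d : Desc u v) → length (vertices d) ≤ k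
  length-vertices≤ {k = k} (ls , |ls|≤k , covered) d = begin
    length (vertices d)             ≡⟨ length-map layer (vertices d) ⟨
    length (map layer (vertices d)) ≤⟨ Unique-⊆⇒length≤ (layers-distinct d) layers⊆ls ⟩
    length ls                       ≤⟨ |ls|≤k ⟩
    k                               ∎
    where
    open ≤-Reasoning
    layers⊆ls : map layer (vertices d) ⊆ ls
    layers⊆ls c∈ with c , c∈vs , refl ← ∈-map⁻ layer c∈ =
      covered c (All.lookup (vertices-descendants d) c∈vs)

  ∈⇒Up : x ∈ P → Up P x
  ∈⇒Up x∈P = _ , x∈P , here

  Up-⊆ᵤ : All (Up P) Q → Up Q ⊆ᵤ Up P
  Up-⊆ᵤ Q↑ y (s , s∈Q , y⇝s) with s′ , s′∈P , s⇝s′ ← All.lookup Q↑ s∈Q =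
    s′ , s′∈P , Desc-trans y⇝s s⇝s′

  -- Up P ⊆ᵤ Up Q′ cannot be decided, but each answer violates one clause of minimality.
  UpwardMinimal⇒shortest : UpwardMinimal u v P → Walk u v Q → All (Up P) Q → length P ≤ length Q
  UpwardMinimal⇒shortest {P = P} (_ , minimal) w Q↑
    with Q′ , Q′-path , |Q′|≤|Q| , Q′⊆Q ← Walk⇒Path w = ≤-trans (≮⇒≥ not-shorter) |Q′|≤|Q|
    where
    Q′↑ : Up Q′ ⊆ᵤ Up P
    Q′↑ = Up-⊆ᵤ (All-resp-⊇ Q′⊆Q Q↑)
    not-shorter : ¬ length Q′ < length P
    not-shorter Q′<P with strictly , equally ← minimal Q′ Q′-path =
      strictly (Q′↑ , λ P↑ → equally (Q′↑ , P↑ , Q′<P))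

  detour-through-root : ∀ {k} → MeetsAtMost (Desc r) k → Desc r x → Desc r z →
    ∃[ X ] Walk x z X × length X < k + k × All (Up (x ∷ [ z ])) X
  detour-through-root {k = k} meets r⇝x r⇝z =
    reverse (vertices r⇝x) ++ steps r⇝z ,
    Walk-reverse (Desc⇒Walk r⇝x) ++ʷ Desc⇒Walk r⇝z ,
    length-bound ,
    All.++⁺ (All.tabulate λ s∈ → _ , here refl , All.lookup (vertices-ancestors r⇝x) (Any.reverse⁻ s∈))
            (All.map (λ s⇝z → _ , there (here refl) , s⇝z) (All.tail (vertices-ancestors r⇝z)))
    where
    open ≤-Reasoning
    length-bound : length (reverse (vertices r⇝x) ++ steps r⇝z) < k + k
    length-bound = begin-strict
      length (reverse (vertices r⇝x) ++ steps r⇝z)          ≡⟨ length-++ (reverse (vertices r⇝x)) ⟩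
      length (reverse (vertices r⇝x)) + length (steps r⇝z) ≡⟨ cong (_+ _) (length-reverse (vertices r⇝x)) ⟩
      length (vertices r⇝x) + length (steps r⇝z)           <⟨ +-mono-≤-< (length-vertices≤ meets r⇝x)
                                                                          (length-vertices≤ meets r⇝z) ⟩
      k + k                                                 ∎

  UpwardMinimal⇒segment< : ∀ B {T S C} → UpwardMinimal u v P → P ≡ B ++ x ∷ T → x ∷ T ≡ S ++ z ∷ C →
    Walk x z X → All (Up (x ∷ [ z ])) X → suc (length S) ≤ length X
  UpwardMinimal⇒segment< {u} {v} {x = x} {z = z} {X = X} B {T} {S} {C} minimal@((P-walk , _) , _) refl T≡ W W↑ =
    begin
      suc (length S)          ≤⟨ s≤s (+-cancelʳ-≤ (length C) _ _ (≤-pred (+-cancelˡ-≤ (length B) _ _ lengths))) ⟩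
      suc (length (drop 1 X)) ≡⟨ length-Walk W ⟨
      length X                ∎
    where
    open ≤-Reasoning
    D : List (Fin n)
    D = drop 1 X
    u⇝x : Walk u x (B ++ [ x ])
    u⇝x = proj₁ (Walk-split B P-walk)
    z⇝v : Walk z v (z ∷ C)
    z⇝v = proj₂ (Walk-split S (subst (Walk x v) T≡ (proj₂ (Walk-split B P-walk))))
    shortcut : Walk u v (((B ++ [ x ]) ++ D) ++ C)
    shortcut = (u⇝x ++ʷ W) ++ʷ z⇝v
    shortcut↑ : All (Up (B ++ x ∷ T)) (((B ++ [ x ]) ++ D) ++ C)
    shortcut↑ = All.++⁺ (All.++⁺ (All.tabulate λ y∈ → ∈⇒Up (++⁺ʳ B (xs⊆xs++ys [ x ] T) y∈))
                                 (All.drop⁺ 1 (All.map (Up-⊆ᵤ xz↑ _) W↑)))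
                        (All.tabulate λ y∈ → ∈⇒Up (segment⊆P (∈-++⁺ʳ S (there y∈))))
      where
      segment⊆P : S ++ z ∷ C ⊆ B ++ x ∷ T
      segment⊆P y∈ = ∈-++⁺ʳ B (subst (_ ∈_) (sym T≡) y∈)
      xz↑ : All (Up (B ++ x ∷ T)) (x ∷ [ z ])
      xz↑ = ∈⇒Up (∈-++⁺ʳ B (here refl)) ∷ ∈⇒Up (segment⊆P (∈-++⁺ʳ S (here refl))) ∷ []
    lengths : length B + suc (length S + length C) ≤ length B + suc (length D + length C)
    lengths = begin
      length B + suc (length S + length C)  ≡⟨ cong (length B +_) (+-suc (length S) (length C)) ⟨
      length B + (length S + suc (length C)) ≡⟨ cong (length B +_) (length-++ S) ⟨
      length B + length (S ++ z ∷ C)        ≡⟨ cong (λ L → length B + length L) T≡ ⟨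
      length B + length (x ∷ T)             ≡⟨ length-++ B ⟨
      length (B ++ x ∷ T)                   ≤⟨ UpwardMinimal⇒shortest minimal shortcut shortcut↑ ⟩
      length (((B ++ [ x ]) ++ D) ++ C)     ≡⟨ cong length (trans (++-assoc (B ++ [ x ]) D C)
                                                                  (++-assoc B [ x ] (D ++ C))) ⟩
      length (B ++ x ∷ D ++ C)              ≡⟨ length-++ B ⟩
      length B + suc (length (D ++ C))      ≡⟨ cong (λ l → length B + suc l) (length-++ D) ⟩
      length B + suc (length D + length C)  ∎

  UpwardMinimal-∩-Desc≤ : ∀ {k} → MeetsAtMost (Desc r) k → UpwardMinimal u v P →
    InterCardAtMost (Desc r) P (2 * k ∸ 1)
  UpwardMinimal-∩-Desc≤ meets minimal [] _ _ = z≤n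
  UpwardMinimal-∩-Desc≤ {k = k} meets minimal xs@(y ∷ _) xs! xs⊆F∩P
    with B , x , T , S , z , C , P≡ , T≡ , x∈xs , z∈xs , xs⊆segment
           ← split-outermost (_∈? xs) (lose (proj₂ (xs⊆F∩P y (here refl))) (here refl))
    with X , W , |X|< , W↑ ← detour-through-root meets (proj₁ (xs⊆F∩P x x∈xs)) (proj₁ (xs⊆F∩P z z∈xs)) =
    subst (length xs ≤_) (pred[m∸n]≡m∸[1+n] (2 * k) 0) (<⇒≤pred (begin-strict
      length xs              ≤⟨ Unique-⊆⇒length≤ xs! (λ y∈ → xs⊆segment y∈ (proj₂ (xs⊆F∩P _ y∈))) ⟩
      length (S ++ [ z ])    ≡⟨ length-++-sucʳ S z [] ⟩
      suc (length (S ++ [])) ≡⟨ cong (λ L → suc (length L)) (++-identityʳ S) ⟩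
      suc (length S)         ≤⟨ UpwardMinimal⇒segment< B minimal P≡ T≡ W W↑ ⟩
      length X               <⟨ |X|< ⟩
      k + k                  ≡⟨ cong (k +_) (+-identityʳ k) ⟨
      2 * k                  ∎))
    where open ≤-Reasoning

lemma3p2 : ∀ {n m : ℕ} (G : Graph n) (layer : Fin n → Fin m) (k : ℕ) →
    1 ≤ k → Layered.ThicknessAtMost G layer k →
    ∀ (r : Fin n) → Layered.Root G layer r →
    ∀ (u v : Fin n) (P : List (Fin n)) → Layered.UpwardMinimal G layer u v P →
    Layered.InterCardAtMost G layer (Layered.Member G layer r) P (2 * k ∸ 1)
lemma3p2 G layer k _ thick r root u v P minimal =
  UpwardMinimal-∩-Desc≤ G layer (thick r root) minimal
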